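{- Let $s$ be a non-empty string whose number $r$ of maximal runs is even. Then the Flashback rule is the unique token-minimal admissible bilateral run-peeling decomposition of $s$: any admissible bilateral run-peeling decomposition of $s$ using exactly $\lceil r/2\rceil$ content tokens chooses $x = L$ and $y = R$ at every peeling step.
   Context: The maximal runs of a non-empty string $s$ are the blocks of its run-length encoding $s = a_1^{m_1}\cdots a_r^{m_r}$ ($m_i\ge1$, $a_i \ne a_{i+1}$). An admissible bilateral run-peeling decomposition of a non-empty string $s$ is built by repeatedly applying the following rule to an active span (initially $s$) until the span is consumed: (Termination) if the active span consists of a single run or of two adjacent runs, emit one terminal token for the span and stop; (Peeling step) otherwise let $L$ be the length of the span's leading run (longest prefix of a single repeated symbol) and $R$ the length of its trailing run (longest suffix of a single repeated symbol), choose any integers $x \in \{1,\ldots,L\}$ and $y \in \{1,\ldots,R\}$, emit one token formed by the peeled prefix of length $x$ and the peeled suffix of length $y$, and recurse on the remaining middle. The emitted tokens are called content tokens. Every admissible decomposition uses at least $\lceil r/2\rceil$ content tokens; token-minimal means using exactly this many. The Flashback rule is $x = L$, $y = R$ at every step. -}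

module Defs where

open import Data.Nat using (ℕ; zero; suc; _+_; _∸_; _≤_; _≥_)
open import Data.List using (List; []; _∷_; length; take; drop; reverse)
open import Data.Sum using (_⊎_)
open import Data.Product using (_×_)
open import Data.Unit using (⊤)
open import Relation.Nullary using (yes; no)
open import Relation.Binary.Definitions using (DecidableEquality)
open import Relation.Binary.PropositionalEquality using (_≡_)

module Strings {A : Set} (_≟_ : DecidableEquality A) where

  runsFrom : A → List A → ℕ
  runsFrom a [] = 1
  runsFrom a (b ∷ t) with a ≟ b
  ... | yes _ = runsFrom b t
  ... | no  _ = suc (runsFrom b t)

  runs : List A → ℕ
  runs [] = 0
  runs (a ∷ t) = runsFrom a t

  leadFrom : A → List A → ℕ
  leadFrom a [] = 1
  leadFrom a (b ∷ t) with a ≟ b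
  ... | yes _ = suc (leadFrom b t)
  ... | no  _ = 1

  leadRun : List A → ℕ
  leadRun [] = 0
  leadRun (a ∷ t) = leadFrom a t

  trailRun : List A → ℕ
  trailRun s = leadRun (reverse s)

  middle : List A → ℕ → ℕ → List A
  middle s x y = drop x (take (length s ∸ y) s)

  data Decomp : List A → Set where
    terminal : ∀ {s} → (runs s ≡ 1 ⊎ runs s ≡ 2) → Decomp s
    peel : ∀ {s} → runs s ≥ 3 → (x y : ℕ) →
           1 ≤ x → x ≤ leadRun s → 1 ≤ y → y ≤ trailRun s →
           Decomp (middle s x y) → Decomp s

  tokens : ∀ {s} → Decomp s → ℕ
  tokens (terminal _) = 1
  tokens (peel _ _ _ _ _ _ _ d) = suc (tokens d)

  Flashback : ∀ {s} → Decomp s → Set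
  Flashback (terminal _) = ⊤
  Flashback {s} (peel _ x y _ _ _ _ d) = (x ≡ leadRun s) × (y ≡ trailRun s) × Flashback d

{-# OPTIONS --safe #-}
module Submission where

-- A non-empty string with r runs has r − 1 boundaries, i.e. adjacent positions
-- carrying different symbols. Peeling x ≤ L symbols from the front destroys at most
-- the boundary that ends the leading run, and destroys it only when x = L; likewise
-- at the back. So every content token removes at most two runs, whence r ≤ 2·tokens,
-- and when r is even a token-minimal decomposition removes exactly two runs at every
-- step, which forces x = L and y = R. Conversely, once r ≥ 3 the leading and trailing
-- runs are separated by a further run, so Flashback steps remove exactly two runs
-- each and end on a two-run span after r/2 tokens.

open import Defs
open import Data.Nat using (ℕ; zero; suc; _+_; _*_; _∸_; _≤_; _<_; z≤n; s≤s; s≤s⁻¹; ⌈_/2⌉)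
open import Data.Nat.Properties
open import Data.Nat.Divisibility using (_∣_; divides)
open import Data.List using (List; []; _∷_; _++_; length; take; drop; reverse; reverseAcc)
open import Data.List.Properties using (take++drop≡id; reverse-++; reverse-involutive; reverse-injective; length-drop; length-reverse)
open import Data.Product using (Σ; _×_; _,_)
open import Data.Sum using (_⊎_; inj₁; inj₂; map₂)
open import Data.Unit using (tt)
open import Function using (_∘_)
open import Relation.Nullary using (¬_; yes; no; contradiction)
open import Relation.Binary.Definitions using (DecidableEquality)
open import Relation.Binary.PropositionalEquality using (_≡_; _≢_; refl; sym; trans; cong; cong₂; subst; subst₂; module ≡-Reasoning)

take-length-++ : ∀ {A : Set} (xs ys : List A) → take (length xs) (xs ++ ys) ≡ xs
take-length-++ []       ys = refl
take-length-++ (x ∷ xs) ys = cong (x ∷_) (take-length-++ xs ys)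

⌈2*n/2⌉≡n : ∀ n → ⌈ 2 * n /2⌉ ≡ n
⌈2*n/2⌉≡n n = trans (cong (λ m → ⌈ n + m /2⌉) (+-identityʳ n)) (sym (n≡⌈n+n/2⌉ n))

module RunPeeling {A : Set} (_≟_ : DecidableEquality A) where
  open Strings _≟_

  boundary : A → A → ℕ
  boundary a b with a ≟ b
  ... | yes _ = 0
  ... | no  _ = 1

  boundaries : List A → ℕ
  boundaries []          = 0
  boundaries (a ∷ [])    = 0
  boundaries (a ∷ b ∷ t) = boundary a b + boundaries (b ∷ t)

  boundary-sym : ∀ a b → boundary a b ≡ boundary b a
  boundary-sym a b with a ≟ b | b ≟ a
  ... | yes _   | yes _   = refl
  ... | no  _   | no  _   = refl
  ... | yes a≡b | no  b≢a = contradiction (sym a≡b) b≢a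
  ... | no  a≢b | yes b≡a = contradiction (sym b≡a) a≢b

  runsFrom≡suc-boundaries : ∀ a t → runsFrom a t ≡ suc (boundaries (a ∷ t))
  runsFrom≡suc-boundaries a []      = refl
  runsFrom≡suc-boundaries a (b ∷ t) with a ≟ b
  ... | yes _ = runsFrom≡suc-boundaries b t
  ... | no  _ = cong suc (runsFrom≡suc-boundaries b t)

  runs≡suc-boundaries : ∀ s → s ≢ [] → runs s ≡ suc (boundaries s)
  runs≡suc-boundaries []      s≢[] = contradiction refl s≢[]
  runs≡suc-boundaries (a ∷ t) _    = runsFrom≡suc-boundaries a t

  0<runs⇒≢[] : ∀ {s} → 0 < runs s → s ≢ []
  0<runs⇒≢[] {[]}    ()
  0<runs⇒≢[] {_ ∷ _} _ ()

  boundaries-reverseAcc : ∀ a acc l →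
    boundaries (reverseAcc (a ∷ acc) l) ≡ boundaries (a ∷ l) + boundaries (a ∷ acc)
  boundaries-reverseAcc a acc []      = refl
  boundaries-reverseAcc a acc (b ∷ l) = begin
    boundaries (reverseAcc (b ∷ a ∷ acc) l)                   ≡⟨ boundaries-reverseAcc b (a ∷ acc) l ⟩
    boundaries (b ∷ l) + (boundary b a + boundaries (a ∷ acc)) ≡⟨ cong (λ c → boundaries (b ∷ l) + (c + boundaries (a ∷ acc))) (boundary-sym b a) ⟩
    boundaries (b ∷ l) + (boundary a b + boundaries (a ∷ acc)) ≡⟨ +-assoc (boundaries (b ∷ l)) _ _ ⟨
    boundaries (b ∷ l) + boundary a b + boundaries (a ∷ acc)   ≡⟨ cong (_+ boundaries (a ∷ acc)) (+-comm (boundaries (b ∷ l)) (boundary a b)) ⟩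
    boundaries (a ∷ b ∷ l) + boundaries (a ∷ acc)              ∎
    where open ≡-Reasoning

  boundaries-reverse : ∀ s → boundaries (reverse s) ≡ boundaries s
  boundaries-reverse []      = refl
  boundaries-reverse (a ∷ l) = trans (boundaries-reverseAcc a [] l) (+-identityʳ _)

  boundaries-drop-<leadRun : ∀ {x} u → x < leadRun u → boundaries (drop x u) ≡ boundaries u
  boundaries-drop-<leadRun {zero}  u           _ = refl
  boundaries-drop-<leadRun {suc x} (a ∷ [])    (s≤s ())
  boundaries-drop-<leadRun {suc x} (a ∷ b ∷ t) x<L with a ≟ b
  ... | yes _ = boundaries-drop-<leadRun (b ∷ t) (s≤s⁻¹ x<L)
  ... | no  _ with () ← s≤s⁻¹ x<L

  boundaries-drop-≤leadRun : ∀ {x} u → x ≤ leadRun u → boundaries u ≤ suc (boundaries (drop x u))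
  boundaries-drop-≤leadRun {zero}  u           _   = n≤1+n _
  boundaries-drop-≤leadRun {suc x} (a ∷ [])    _   = z≤n
  boundaries-drop-≤leadRun {suc x} (a ∷ b ∷ t) x≤L with a ≟ b | x≤L
  ... | yes _ | s≤s x≤L′ = boundaries-drop-≤leadRun (b ∷ t) x≤L′
  ... | no  _ | s≤s z≤n  = ≤-refl

  boundaries-drop-leadRun : ∀ u → 0 < boundaries u → boundaries u ≡ suc (boundaries (drop (leadRun u) u))
  boundaries-drop-leadRun (a ∷ [])    ()
  -- The recursive call sits in the with-scrutinee, where b ∷ t is visibly smaller.
  boundaries-drop-leadRun (a ∷ b ∷ t) pos with a ≟ b | boundaries-drop-leadRun (b ∷ t)
  ... | yes _ | ih = ih pos
  ... | no  _ | _  = refl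

  drop-leadRun≢[] : ∀ u → 0 < boundaries u → drop (leadRun u) u ≢ []
  drop-leadRun≢[] (a ∷ [])    ()
  drop-leadRun≢[] (a ∷ b ∷ t) pos with a ≟ b | drop-leadRun≢[] (b ∷ t)
  ... | yes _ | ih = ih pos
  ... | no  _ | _  = λ ()

  boundaries-take≡0⊎leadRun-take≡leadRun : ∀ m s →
    boundaries (take m s) ≡ 0 ⊎ leadRun (take m s) ≡ leadRun s
  boundaries-take≡0⊎leadRun-take≡leadRun zero          s           = inj₁ refl
  boundaries-take≡0⊎leadRun-take≡leadRun (suc m)       []          = inj₁ refl
  boundaries-take≡0⊎leadRun-take≡leadRun 1             (a ∷ t)     = inj₁ refl
  boundaries-take≡0⊎leadRun-take≡leadRun (suc (suc m)) (a ∷ [])    = inj₁ refl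
  boundaries-take≡0⊎leadRun-take≡leadRun (suc (suc m)) (a ∷ b ∷ t)
    with a ≟ b | boundaries-take≡0⊎leadRun-take≡leadRun (suc m) (b ∷ t)
  ... | yes _ | ih = map₂ (cong suc) ih
  ... | no  _ | _  = inj₂ refl

  boundaries-drop-take-≤ : ∀ {x} m s → x ≤ leadRun s →
    boundaries (take m s) ≤ suc (boundaries (drop x (take m s)))
  boundaries-drop-take-≤ m s x≤L with boundaries-take≡0⊎leadRun-take≡leadRun m s
  ... | inj₁ flat = ≤-trans (≤-reflexive flat) z≤n
  ... | inj₂ same = boundaries-drop-≤leadRun (take m s) (subst (_ ≤_) (sym same) x≤L)

  boundaries-drop-take-< : ∀ {x} m s → x < leadRun s →
    boundaries (take m s) ≤ boundaries (drop x (take m s))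
  boundaries-drop-take-< m s x<L with boundaries-take≡0⊎leadRun-take≡leadRun m s
  ... | inj₁ flat = ≤-trans (≤-reflexive flat) z≤n
  ... | inj₂ same = ≤-reflexive (sym (boundaries-drop-<leadRun (take m s) (subst (_ <_) (sym same) x<L)))

  dropLast : ℕ → List A → List A
  dropLast y s = take (length s ∸ y) s

  dropLast-reverse : ∀ y r → dropLast y (reverse r) ≡ reverse (drop y r)
  dropLast-reverse y r = begin
    take (length (reverse r) ∸ y) (reverse r) ≡⟨ cong₂ take length≡ reverse≡ ⟩
    take (length front) (front ++ back)       ≡⟨ take-length-++ front back ⟩
    front                                     ∎
    where
      open ≡-Reasoning
      front back : List A
      front = reverse (drop y r)
      back  = reverse (take y r)
      length≡ : length (reverse r) ∸ y ≡ length front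
      length≡ = trans (cong (_∸ y) (length-reverse r))
                      (trans (sym (length-drop y r)) (sym (length-reverse (drop y r))))
      reverse≡ : reverse r ≡ front ++ back
      reverse≡ = trans (cong reverse (sym (take++drop≡id y r))) (reverse-++ (take y r) (drop y r))

  boundaries-dropLast : ∀ y s → boundaries (dropLast y s) ≡ boundaries (drop y (reverse s))
  boundaries-dropLast y s = begin
    boundaries (dropLast y s)                     ≡⟨ cong (boundaries ∘ dropLast y) (reverse-involutive s) ⟨
    boundaries (dropLast y (reverse (reverse s))) ≡⟨ cong boundaries (dropLast-reverse y (reverse s)) ⟩
    boundaries (reverse (drop y (reverse s)))     ≡⟨ boundaries-reverse (drop y (reverse s)) ⟩
    boundaries (drop y (reverse s))               ∎
    where open ≡-Reasoning

  boundaries-dropLast-≤ : ∀ {y} s → y ≤ trailRun s → boundaries s ≤ suc (boundaries (dropLast y s))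
  boundaries-dropLast-≤ {y} s y≤R =
    subst₂ (λ b c → b ≤ suc c) (boundaries-reverse s) (sym (boundaries-dropLast y s))
      (boundaries-drop-≤leadRun (reverse s) y≤R)

  boundaries-dropLast-< : ∀ {y} s → y < trailRun s → boundaries s ≡ boundaries (dropLast y s)
  boundaries-dropLast-< {y} s y<R = begin
    boundaries s                    ≡⟨ boundaries-reverse s ⟨
    boundaries (reverse s)          ≡⟨ boundaries-drop-<leadRun (reverse s) y<R ⟨
    boundaries (drop y (reverse s)) ≡⟨ boundaries-dropLast y s ⟨
    boundaries (dropLast y s)       ∎
    where open ≡-Reasoning

  boundaries-dropLast-trailRun : ∀ s → 0 < boundaries s →
    boundaries s ≡ suc (boundaries (dropLast (trailRun s) s))
  boundaries-dropLast-trailRun s pos = begin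
    boundaries s                                          ≡⟨ boundaries-reverse s ⟨
    boundaries (reverse s)                                ≡⟨ boundaries-drop-leadRun (reverse s) pos′ ⟩
    suc (boundaries (drop (trailRun s) (reverse s)))      ≡⟨ cong suc (boundaries-dropLast (trailRun s) s) ⟨
    suc (boundaries (dropLast (trailRun s) s))            ∎
    where
      open ≡-Reasoning
      pos′ : 0 < boundaries (reverse s)
      pos′ = subst (0 <_) (sym (boundaries-reverse s)) pos

  boundaries-peel-≤ : ∀ {x y} s → x ≤ leadRun s → y ≤ trailRun s →
    boundaries s ≤ 2 + boundaries (middle s x y)
  boundaries-peel-≤ {y = y} s x≤L y≤R =
    ≤-trans (boundaries-dropLast-≤ s y≤R) (s≤s (boundaries-drop-take-≤ (length s ∸ y) s x≤L))

  boundaries-peel-partial : ∀ {x y} s → x ≤ leadRun s → y ≤ trailRun s →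
    x < leadRun s ⊎ y < trailRun s → boundaries s ≤ 1 + boundaries (middle s x y)
  boundaries-peel-partial {y = y} s x≤L y≤R (inj₁ x<L) =
    ≤-trans (boundaries-dropLast-≤ s y≤R) (s≤s (boundaries-drop-take-< (length s ∸ y) s x<L))
  boundaries-peel-partial {y = y} s x≤L y≤R (inj₂ y<R) =
    ≤-trans (≤-reflexive (boundaries-dropLast-< s y<R)) (boundaries-drop-take-≤ (length s ∸ y) s x≤L)

  boundaries-peel-flashback : ∀ s → 2 ≤ boundaries s →
    middle s (leadRun s) (trailRun s) ≢ [] ×
    boundaries s ≡ 2 + boundaries (middle s (leadRun s) (trailRun s))
  boundaries-peel-flashback s 2≤B =
    subst (λ n → drop n u ≢ []) leadRun-u (drop-leadRun≢[] u u-pos) ,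
    trans s≡ (cong suc (subst (λ n → boundaries u ≡ suc (boundaries (drop n u))) leadRun-u
                                (boundaries-drop-leadRun u u-pos)))
    where
      u : List A
      u = dropLast (trailRun s) s
      s≡ : boundaries s ≡ suc (boundaries u)
      s≡ = boundaries-dropLast-trailRun s (≤-trans (n≤1+n 1) 2≤B)
      u-pos : 0 < boundaries u
      u-pos = s≤s⁻¹ (subst (2 ≤_) s≡ 2≤B)
      leadRun-u : leadRun u ≡ leadRun s
      leadRun-u with boundaries-take≡0⊎leadRun-take≡leadRun (length s ∸ trailRun s) s
      ... | inj₁ flat = contradiction u-pos (<-irrefl (sym flat))
      ... | inj₂ same = same

  runs-peel-≤ : ∀ {x y} s → s ≢ [] → middle s x y ≢ [] → x ≤ leadRun s → y ≤ trailRun s →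
    runs s ≤ 2 + runs (middle s x y)
  runs-peel-≤ {x} {y} s s≢[] m≢[] x≤L y≤R = begin
    runs s                                ≡⟨ runs≡suc-boundaries s s≢[] ⟩
    suc (boundaries s)                    ≤⟨ s≤s (boundaries-peel-≤ s x≤L y≤R) ⟩
    2 + suc (boundaries (middle s x y))   ≡⟨ cong (2 +_) (runs≡suc-boundaries (middle s x y) m≢[]) ⟨
    2 + runs (middle s x y)               ∎
    where open ≤-Reasoning

  runs-peel-exact : ∀ {x y} s → s ≢ [] → middle s x y ≢ [] → x ≤ leadRun s → y ≤ trailRun s →
    2 + runs (middle s x y) ≤ runs s → x ≡ leadRun s × y ≡ trailRun s
  runs-peel-exact {x} {y} s s≢[] m≢[] x≤L y≤R exact =
    ≤-antisym x≤L (≮⇒≥ (not-partial ∘ inj₁)) , ≤-antisym y≤R (≮⇒≥ (not-partial ∘ inj₂))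
    where
      not-partial : ¬ (x < leadRun s ⊎ y < trailRun s)
      not-partial partial = n≮n (1 + runs (middle s x y)) (begin-strict
        1 + runs (middle s x y)             <⟨ exact ⟩
        runs s                              ≡⟨ runs≡suc-boundaries s s≢[] ⟩
        suc (boundaries s)                  ≤⟨ s≤s (boundaries-peel-partial s x≤L y≤R partial) ⟩
        2 + boundaries (middle s x y)       ≡⟨ cong suc (runs≡suc-boundaries (middle s x y) m≢[]) ⟨
        1 + runs (middle s x y)             ∎)
        where open ≤-Reasoning

  runs-peel-flashback : ∀ s → 3 ≤ runs s → runs s ≡ 2 + runs (middle s (leadRun s) (trailRun s))
  runs-peel-flashback s 3≤r =
    let m≢[] , B≡ = boundaries-peel-flashback s 2≤B in begin
      runs s                 ≡⟨ runs≡suc-boundaries s s≢[] ⟩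
      suc (boundaries s)     ≡⟨ cong suc B≡ ⟩
      2 + suc (boundaries m) ≡⟨ cong (2 +_) (runs≡suc-boundaries m m≢[]) ⟨
      2 + runs m             ∎
    where
      open ≡-Reasoning
      m : List A
      m = middle s (leadRun s) (trailRun s)
      s≢[] : s ≢ []
      s≢[] = 0<runs⇒≢[] (≤-trans (s≤s z≤n) 3≤r)
      2≤B : 2 ≤ boundaries s
      2≤B = s≤s⁻¹ (subst (3 ≤_) (runs≡suc-boundaries s s≢[]) 3≤r)

  Decomp⇒≢[] : ∀ {s} → Decomp s → s ≢ []
  Decomp⇒≢[] (terminal (inj₁ ())) refl
  Decomp⇒≢[] (terminal (inj₂ ())) refl
  Decomp⇒≢[] (peel () _ _ _ _ _ _ _) refl

  runs≤2*tokens : ∀ {s} (d : Decomp s) → runs s ≤ 2 * tokens d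
  runs≤2*tokens (terminal (inj₁ r≡1)) = ≤-trans (≤-reflexive r≡1) (n≤1+n 1)
  runs≤2*tokens (terminal (inj₂ r≡2)) = ≤-reflexive r≡2
  runs≤2*tokens {s} p@(peel _ x y _ x≤L _ y≤R d) = begin
    runs s                  ≤⟨ runs-peel-≤ s (Decomp⇒≢[] p) (Decomp⇒≢[] d) x≤L y≤R ⟩
    2 + runs (middle s x y) ≤⟨ +-monoʳ-≤ 2 (runs≤2*tokens d) ⟩
    2 + 2 * tokens d        ≡⟨ *-suc 2 (tokens d) ⟨
    2 * tokens p            ∎
    where open ≤-Reasoning

  tight⇒Flashback : ∀ {s} (d : Decomp s) → runs s ≡ 2 * tokens d → Flashback d
  tight⇒Flashback (terminal _) _ = tt
  tight⇒Flashback {s} p@(peel _ x y _ x≤L _ y≤R d) r≡ =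
    let x≡L , y≡R = flashback-step in x≡L , y≡R , tight⇒Flashback d runs-middle≡
    where
      r≡′ : runs s ≡ 2 + 2 * tokens d
      r≡′ = trans r≡ (*-suc 2 (tokens d))
      runs-middle≡ : runs (middle s x y) ≡ 2 * tokens d
      runs-middle≡ = ≤-antisym (runs≤2*tokens d)
        (+-cancelˡ-≤ 2 _ _ (subst (_≤ 2 + runs (middle s x y)) r≡′
                                    (runs-peel-≤ s (Decomp⇒≢[] p) (Decomp⇒≢[] d) x≤L y≤R)))
      flashback-step : x ≡ leadRun s × y ≡ trailRun s
      flashback-step = runs-peel-exact s (Decomp⇒≢[] p) (Decomp⇒≢[] d) x≤L y≤R
        (≤-reflexive (trans (cong (2 +_) runs-middle≡) (sym r≡′)))

  0<leadRun : ∀ s → s ≢ [] → 0 < leadRun s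
  0<leadRun []          s≢[] = contradiction refl s≢[]
  0<leadRun (a ∷ [])    _    = ≤-refl
  0<leadRun (a ∷ b ∷ t) _ with a ≟ b
  ... | yes _ = s≤s z≤n
  ... | no  _ = ≤-refl

  flashback-decomp : ∀ k s → runs s ≡ 2 * suc k →
    Σ (Decomp s) (λ d → Flashback d × tokens d ≡ suc k)
  flashback-decomp zero    s r≡2 = terminal (inj₂ r≡2) , tt , refl
  flashback-decomp (suc k) s r≡  =
    let d , fb , t≡ = flashback-decomp k (middle s (leadRun s) (trailRun s)) runs-middle≡ in
    peel 3≤r (leadRun s) (trailRun s) (0<leadRun s s≢[]) ≤-refl
         (0<leadRun (reverse s) (s≢[] ∘ reverse-injective)) ≤-refl d ,
    (refl , refl , fb) , cong suc t≡
    where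
      3≤r : 3 ≤ runs s
      3≤r = subst (3 ≤_) (sym r≡) (≤-trans (n≤1+n 3) (*-monoʳ-≤ 2 (s≤s (s≤s z≤n))))
      s≢[] : s ≢ []
      s≢[] = 0<runs⇒≢[] (≤-trans (s≤s z≤n) 3≤r)
      runs-middle≡ : runs (middle s (leadRun s) (trailRun s)) ≡ 2 * suc k
      runs-middle≡ = +-cancelˡ-≡ 2 _ _
        (trans (sym (runs-peel-flashback s 3≤r)) (trans r≡ (*-suc 2 (suc k))))

mainTheorem10 : {A : Set} (_≟_ : DecidableEquality A) (s : List A) →
    ¬ (s ≡ []) → 2 ∣ Strings.runs _≟_ s →
    Σ (Strings.Decomp _≟_ s) (λ d → Strings.Flashback _≟_ d × Strings.tokens _≟_ d ≡ ⌈ Strings.runs _≟_ s /2⌉)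
    × ((d : Strings.Decomp _≟_ s) → Strings.tokens _≟_ d ≡ ⌈ Strings.runs _≟_ s /2⌉ → Strings.Flashback _≟_ d)
mainTheorem10 _≟_ s s≢[] (divides zero r≡0) =
  contradiction (trans (sym r≡0) (RunPeeling.runs≡suc-boundaries _≟_ s s≢[])) λ ()
mainTheorem10 _≟_ s _ (divides (suc k) r≡) = minimal , unique
  where
    open Strings _≟_
    open RunPeeling _≟_
    r≡2k : runs s ≡ 2 * suc k
    r≡2k = trans r≡ (*-comm (suc k) 2)
    ⌈r/2⌉≡ : ⌈ runs s /2⌉ ≡ suc k
    ⌈r/2⌉≡ = trans (cong ⌈_/2⌉ r≡2k) (⌈2*n/2⌉≡n (suc k))
    minimal : Σ (Decomp s) (λ d → Flashback d × tokens d ≡ ⌈ runs s /2⌉)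
    minimal = let d , fb , t≡ = flashback-decomp k s r≡2k in d , fb , trans t≡ (sym ⌈r/2⌉≡)
    unique : (d : Decomp s) → tokens d ≡ ⌈ runs s /2⌉ → Flashback d
    unique d t≡ = tight⇒Flashback d (trans r≡2k (cong (2 *_) (sym (trans t≡ ⌈r/2⌉≡))))
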